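{- Let $G$ be a 2-vertex-connected graph on $n$ vertices and let $\alpha$ be a linear arrangement of $G$. Then $\mathrm{nc}(\alpha,G)\ge n-2$.
   Context: Graphs are finite, without loops or parallel edges. A linear arrangement of $G=(V,E)$ is a bijection $\alpha:V\to\{1,\dots,|V|\}$, and $\mathrm{nc}(\alpha,G)=\sum_{uv\in E}(|\alpha(u)-\alpha(v)|-1)$. -}

module Defs where

open import Data.Nat using (ℕ; zero; suc; _∸_; _<ᵇ_; ∣_-_∣; _<_)
open import Data.Fin using (Fin; toℕ)
open import Data.Bool using (Bool; true; false; _∧_; if_then_else_)
open import Data.List using (List; map; allFin)
open import Data.Nat.ListAction using (sum)
open import Data.Unit using (⊤)
open import Relation.Binary.PropositionalEquality using (_≡_; _≢_)
open import Function.Bundles using (Bijection)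
open import Function using (_⤖_)

record Graph (n : ℕ) : Set where
  field
    adj   : Fin n → Fin n → Bool
    sym   : ∀ u v → adj u v ≡ adj v u
    irrefl : ∀ u → adj u u ≡ false
open Graph public

data Reach {n : ℕ} (G : Graph n) (P : Fin n → Set) : Fin n → Fin n → Set where
  here : ∀ {u} → P u → Reach G P u u
  step : ∀ {u v w} → P u → adj G u v ≡ true → Reach G P v w → Reach G P u w

Connected : {n : ℕ} → Graph n → Set
Connected G = ∀ u v → Reach G (λ _ → ⊤) u v

ConnectedWithout : {n : ℕ} → Graph n → Fin n → Set
ConnectedWithout G x = ∀ u v → u ≢ x → v ≢ x → Reach G (λ w → w ≢ x) u v

data TwoConnected {n : ℕ} (G : Graph n) : Set where
  mk2c : 2 < n → Connected G → (∀ x → ConnectedWithout G x) → TwoConnected G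

-- A linear arrangement: a bijection from the vertices to the positions.
-- Positions are 0..n-1 (Fin n) instead of 1..n; only differences matter.
LinearArrangement : ℕ → Set
LinearArrangement n = Fin n ⤖ Fin n

nc : {n : ℕ} → LinearArrangement n → Graph n → ℕ
nc {n} α G =
  sum (map (λ u → sum (map (λ v →
         if (toℕ u <ᵇ toℕ v) ∧ adj G u v
         then ∣ toℕ (f u) - toℕ (f v) ∣ ∸ 1
         else 0) (allFin n))) (allFin n))
  where f = Bijection.to α

{-# OPTIONS --safe #-}
-- Every position p with 0 < p < n − 1 is jumped over by an edge: G minus the
-- vertex at position p is connected, so a walk in it from the vertex at
-- position 0 to the vertex at position p + 1 must use an edge from a position
-- below p to a position above p.  An edge uv is jumped over at exactly
-- |α(u) − α(v)| − 1 positions, so counting the pairs (edge, position jumped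
-- over) in both ways gives nc(α, G) ≥ n − 2.
module Submission where

open import Defs renaming (sym to adj-sym; irrefl to adj-irrefl)
open import Data.Bool using (Bool; true; false; _∧_; if_then_else_)
open import Data.Bool.Properties using (T-≡)
open import Data.Empty using (⊥-elim)
open import Data.Fin using (Fin; zero; suc; toℕ; fromℕ<)
open import Data.Fin.Properties using (toℕ-injective; toℕ-fromℕ<; toℕ-fromℕ; toℕ-inject₁)
open import Data.List using (map; tabulate; allFin)
open import Data.List.Properties using (map-tabulate)
import Data.Nat.ListAction as ListAction
open import Data.Nat using (ℕ; zero; suc; pred; _+_; _∸_; _⊓_; _⊔_; _≤_; _<_; _<ᵇ_; ∣_-_∣; z≤n; s≤s; _<?_)
open import Data.Nat.Properties
open import Algebra.Properties.CommutativeMonoid.Sum +-0-commutativeMonoid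
  using (sum-syntax; sum-cong-≗; sum-init-last; sum-replicate-zero; ∑-comm)
open import Data.Product using (∃₂; _×_; _,_; proj₁; proj₂)
open import Function using (_∘_; id)
open import Function.Bundles using (Bijection; Equivalence)
open import Relation.Binary using (tri<; tri≈; tri>)
open import Relation.Binary.PropositionalEquality
open import Relation.Nullary using (yes; no)

∑-mono-≤ : ∀ {k} {f g : Fin k → ℕ} → (∀ i → f i ≤ g i) → ∑[ i < k ] f i ≤ ∑[ i < k ] g i
∑-mono-≤ {zero}  _   = z≤n
∑-mono-≤ {suc k} f≤g = +-mono-≤ (f≤g zero) (∑-mono-≤ (f≤g ∘ suc))

≤-∑ : ∀ {k} (f : Fin k → ℕ) i → f i ≤ ∑[ j < k ] f j
≤-∑ f zero    = m≤m+n (f zero) _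
≤-∑ f (suc i) = ≤-trans (≤-∑ (f ∘ suc) i) (m≤n+m _ (f zero))

∑-toℕ-last : ∀ k (h : ℕ → ℕ) → ∑[ p < suc k ] h (toℕ p) ≡ ∑[ p < k ] h (toℕ p) + h k
∑-toℕ-last k h = trans (sum-init-last {k} (h ∘ toℕ))
  (cong₂ _+_ (sum-cong-≗ {k} (cong h ∘ toℕ-inject₁)) (cong h (toℕ-fromℕ k)))

sum-tabulate : ∀ {k} (f : Fin k → ℕ) → ListAction.sum (tabulate f) ≡ ∑[ i < k ] f i
sum-tabulate {zero}  f = refl
sum-tabulate {suc k} f = cong (f zero +_) (sum-tabulate (f ∘ suc))

sum-map-allFin : ∀ k (f : Fin k → ℕ) → ListAction.sum (map f (allFin k)) ≡ ∑[ i < k ] f i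
sum-map-allFin k f = trans (cong ListAction.sum (map-tabulate id f)) (sum-tabulate f)

𝟙[_<_<_] : ℕ → ℕ → ℕ → ℕ
𝟙[ a < p < b ] with p <? b | a <? p
... | yes _ | yes _ = 1
... | _     | _     = 0

𝟙[<<]-≡1 : ∀ {a p b} → a < p → p < b → 𝟙[ a < p < b ] ≡ 1
𝟙[<<]-≡1 {a} {p} {b} a<p p<b with p <? b | a <? p
... | yes _   | yes _   = refl
... | no p≮b  | _       = ⊥-elim (p≮b p<b)
... | yes _   | no a≮p  = ⊥-elim (a≮p a<p)

𝟙[<<]-≤ : ∀ {a p b x} → (a < p → p < b → 1 ≤ x) → 𝟙[ a < p < b ] ≤ x
𝟙[<<]-≤ {a} {p} {b} h with p <? b | a <? p
... | yes p<b | yes a<p = h a<p p<b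
... | no _    | _       = z≤n
... | yes _   | no _    = z≤n

∑-𝟙[<<] : ∀ a b k → ∑[ p < k ] 𝟙[ a < toℕ p < b ] ≡ k ⊓ b ∸ suc a
∑-𝟙[<<] a b zero    = refl
∑-𝟙[<<] a b (suc k) = begin
  ∑[ p < suc k ] 𝟙[ a < toℕ p < b ]              ≡⟨ ∑-toℕ-last k (λ p → 𝟙[ a < p < b ]) ⟩
  ∑[ p < k ] 𝟙[ a < toℕ p < b ] + 𝟙[ a < k < b ] ≡⟨ cong (_+ 𝟙[ a < k < b ]) (∑-𝟙[<<] a b k) ⟩
  k ⊓ b ∸ suc a + 𝟙[ a < k < b ]                 ≡⟨ extend ⟩
  suc k ⊓ b ∸ suc a                              ∎
  where
  open ≡-Reasoning
  extend : k ⊓ b ∸ suc a + 𝟙[ a < k < b ] ≡ suc k ⊓ b ∸ suc a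
  extend with k <? b | a <? k
  ... | yes k<b | yes a<k
    rewrite m≤n⇒m⊓n≡m (<⇒≤ k<b) | m≤n⇒m⊓n≡m k<b = trans (+-comm _ 1) (sym (+-∸-assoc 1 a<k))
  ... | yes k<b | no a≮k
    rewrite m≤n⇒m⊓n≡m (<⇒≤ k<b) | m≤n⇒m⊓n≡m k<b
          | m≤n⇒m∸n≡0 (m≤n⇒m≤1+n (≮⇒≥ a≮k)) | m≤n⇒m∸n≡0 (≮⇒≥ a≮k) = refl
  ... | no k≮b  | _
    rewrite m≥n⇒m⊓n≡n (≮⇒≥ k≮b) | m≥n⇒m⊓n≡n (m≤n⇒m≤1+n (≮⇒≥ k≮b)) = +-identityʳ _

∣m-n∣∸1≡m⊔n∸[1+m⊓n] : ∀ m n → ∣ m - n ∣ ∸ 1 ≡ m ⊔ n ∸ suc (m ⊓ n)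
∣m-n∣∸1≡m⊔n∸[1+m⊓n] zero    n       = refl
∣m-n∣∸1≡m⊔n∸[1+m⊓n] (suc m) zero    = refl
∣m-n∣∸1≡m⊔n∸[1+m⊓n] (suc m) (suc n) = ∣m-n∣∸1≡m⊔n∸[1+m⊓n] m n

∑-𝟙[⊓<<⊔]≤∣m-n∣∸1 : ∀ k m n → ∑[ p < k ] 𝟙[ m ⊓ n < toℕ p < m ⊔ n ] ≤ ∣ m - n ∣ ∸ 1
∑-𝟙[⊓<<⊔]≤∣m-n∣∸1 k m n = begin
  ∑[ p < k ] 𝟙[ m ⊓ n < toℕ p < m ⊔ n ] ≡⟨ ∑-𝟙[<<] (m ⊓ n) (m ⊔ n) k ⟩
  k ⊓ (m ⊔ n) ∸ suc (m ⊓ n)             ≤⟨ ∸-monoˡ-≤ (suc (m ⊓ n)) (m⊓n≤n k (m ⊔ n)) ⟩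
  m ⊔ n ∸ suc (m ⊓ n)                   ≡⟨ ∣m-n∣∸1≡m⊔n∸[1+m⊓n] m n ⟨
  ∣ m - n ∣ ∸ 1                         ∎
  where open ≤-Reasoning

module DoubleCounting {n : ℕ} (edge : Fin n → Fin n → Bool) (pos : Fin n → ℕ) where

  stretch : Fin n → Fin n → ℕ
  stretch u v = if edge u v then ∣ pos u - pos v ∣ ∸ 1 else 0

  jumps : Fin n → Fin n → ℕ → ℕ
  jumps u v p = if edge u v then 𝟙[ pos u ⊓ pos v < p < pos u ⊔ pos v ] else 0

  crossings : ℕ → ℕ
  crossings p = ∑[ u < n ] ∑[ v < n ] jumps u v p

  ∑-jumps≤stretch : ∀ k u v → ∑[ p < k ] jumps u v (toℕ p) ≤ stretch u v
  ∑-jumps≤stretch k u v with edge u v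
  ... | true  = ∑-𝟙[⊓<<⊔]≤∣m-n∣∸1 k (pos u) (pos v)
  ... | false = ≤-reflexive (sum-replicate-zero k)

  ∑-crossings≤∑∑-stretch : ∀ k → ∑[ p < k ] crossings (toℕ p) ≤ ∑[ u < n ] ∑[ v < n ] stretch u v
  ∑-crossings≤∑∑-stretch k = begin
    ∑[ p < k ] ∑[ u < n ] ∑[ v < n ] jumps u v (toℕ p)
      ≡⟨ ∑-comm {n} {k} (λ u p → ∑[ v < n ] jumps u v (toℕ p)) ⟨
    ∑[ u < n ] ∑[ p < k ] ∑[ v < n ] jumps u v (toℕ p)
      ≡⟨ sum-cong-≗ {n} (λ u → ∑-comm {k} {n} (λ p v → jumps u v (toℕ p))) ⟩
    ∑[ u < n ] ∑[ v < n ] ∑[ p < k ] jumps u v (toℕ p)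
      ≤⟨ ∑-mono-≤ (λ u → ∑-mono-≤ (∑-jumps≤stretch k u)) ⟩
    ∑[ u < n ] ∑[ v < n ] stretch u v ∎
    where open ≤-Reasoning

  edge-jumps⇒crossed : ∀ {u v p} → edge u v ≡ true →
    pos u ⊓ pos v < p → p < pos u ⊔ pos v → 1 ≤ crossings p
  edge-jumps⇒crossed {u} {v} {p} e lo hi = begin
    1                                      ≡⟨ 𝟙[<<]-≡1 lo hi ⟨
    𝟙[ pos u ⊓ pos v < p < pos u ⊔ pos v ] ≡⟨ cong (if_then _ else 0) e ⟨
    jumps u v p                            ≤⟨ ≤-∑ (λ v → jumps u v p) v ⟩
    ∑[ w < n ] jumps u w p                 ≤⟨ ≤-∑ (λ u → ∑[ w < n ] jumps u w p) u ⟩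
    crossings p                            ∎
    where open ≤-Reasoning

Reach-source : ∀ {n} {G : Graph n} {P : Fin n → Set} {u w} → Reach G P u w → P u
Reach-source (here Pu)     = Pu
Reach-source (step Pu _ _) = Pu

Reach-map : ∀ {n} {G : Graph n} {P Q : Fin n → Set} → (∀ {z} → P z → Q z) →
  ∀ {u w} → Reach G P u w → Reach G Q u w
Reach-map P⇒Q (here Pu)     = here (P⇒Q Pu)
Reach-map P⇒Q (step Pu e r) = step (P⇒Q Pu) e (Reach-map P⇒Q r)

walk-crosses : ∀ {n} (G : Graph n) (pos : Fin n → ℕ) (p : ℕ) {u w} →
  Reach G (λ z → pos z ≢ p) u w → pos u < p → p < pos w →
  ∃₂ λ a b → adj G a b ≡ true × pos a < p × p < pos b
walk-crosses G pos p (here _) pu<p p<pw = ⊥-elim (<-asym pu<p p<pw)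
walk-crosses G pos p {u} (step {v = v} _ e r) pu<p p<pw with <-cmp (pos v) p
... | tri< pv<p _ _ = walk-crosses G pos p r pv<p p<pw
... | tri≈ _ pv≡p _ = ⊥-elim (Reach-source r pv≡p)
... | tri> _ _ p<pv = u , v , e , pu<p , p<pv

adj⇒≢ : ∀ {n} (G : Graph n) {u v} → adj G u v ≡ true → u ≢ v
adj⇒≢ G {u} e refl with trans (sym (adj-irrefl G u)) e
... | ()

m<pred[n]⇒1+m<n : ∀ {m n} → m < pred n → suc m < n
m<pred[n]⇒1+m<n {n = suc _} m<n = s≤s m<n

module Arrangement {n : ℕ} (α : LinearArrangement n) where

  pos : Fin n → ℕ
  pos u = toℕ (Bijection.to α u)

  pos-injective : ∀ {u v} → pos u ≡ pos v → u ≡ v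
  pos-injective = Bijection.injective α ∘ toℕ-injective

  vertexAt : ∀ q → q < n → Fin n
  vertexAt q q<n = proj₁ (Bijection.strictlySurjective α (fromℕ< q<n))

  pos-vertexAt : ∀ q (q<n : q < n) → pos (vertexAt q q<n) ≡ q
  pos-vertexAt q q<n =
    trans (cong toℕ (proj₂ (Bijection.strictlySurjective α (fromℕ< q<n)))) (toℕ-fromℕ< q<n)

  vertexAt-≢ : ∀ {q r} (q<n : q < n) (r<n : r < n) → q ≢ r → vertexAt q q<n ≢ vertexAt r r<n
  vertexAt-≢ q<n r<n q≢r eq =
    q≢r (trans (sym (pos-vertexAt _ q<n)) (trans (cong pos eq) (pos-vertexAt _ r<n)))

module _ {n : ℕ} (G : Graph n) (α : LinearArrangement n) where

  open Arrangement α

  edge : Fin n → Fin n → Bool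
  edge u v = (toℕ u <ᵇ toℕ v) ∧ adj G u v

  adj⇒edge : ∀ {u v} → toℕ u < toℕ v → adj G u v ≡ true → edge u v ≡ true
  adj⇒edge u<v e rewrite Equivalence.to T-≡ (<⇒<ᵇ u<v) | e = refl

  open DoubleCounting edge pos

  nc≡∑∑-stretch : nc α G ≡ ∑[ u < n ] ∑[ v < n ] stretch u v
  nc≡∑∑-stretch = trans (sum-map-allFin n _) (sum-cong-≗ {n} (λ u → sum-map-allFin n _))

  adj-jumping⇒crossed : ∀ {a b p} → adj G a b ≡ true → pos a < p → p < pos b → 1 ≤ crossings p
  adj-jumping⇒crossed {a} {b} e pa<p p<pb with <-cmp (toℕ a) (toℕ b)
  ... | tri< a<b _ _ = edge-jumps⇒crossed (adj⇒edge a<b e)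
    (≤-<-trans (m⊓n≤m _ _) pa<p) (<-≤-trans p<pb (m≤n⊔m _ _))
  ... | tri≈ _ a≡b _ = ⊥-elim (adj⇒≢ G e (toℕ-injective a≡b))
  ... | tri> _ _ b<a = edge-jumps⇒crossed (adj⇒edge b<a (trans (adj-sym G b a) e))
    (≤-<-trans (m⊓n≤n _ _) pa<p) (<-≤-trans p<pb (m≤m⊔n _ _))

  interior-crossed : (∀ x → ConnectedWithout G x) → ∀ {p} → 0 < p → p < pred n → 1 ≤ crossings p
  interior-crossed 2conn {p} 0<p p<pred[n] =
    let _ , _ , e , pa<p , p<pb = crossing in adj-jumping⇒crossed e pa<p p<pb
    where
    1+p<n : suc p < n
    1+p<n = m<pred[n]⇒1+m<n p<pred[n]
    p<n : p < n
    p<n = <-trans (n<1+n p) 1+p<n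
    0<n : 0 < n
    0<n = <-trans 0<p p<n
    x = vertexAt p p<n
    s = vertexAt 0 0<n
    t = vertexAt (suc p) 1+p<n
    avoids : ∀ {z} → z ≢ x → pos z ≢ p
    avoids z≢x pz≡p = z≢x (pos-injective (trans pz≡p (sym (pos-vertexAt p p<n))))
    walk : Reach G (λ z → pos z ≢ p) s t
    walk = Reach-map avoids (2conn x s t (vertexAt-≢ 0<n p<n (<⇒≢ 0<p)) (vertexAt-≢ 1+p<n p<n 1+n≢n))
    crossing : ∃₂ λ a b → adj G a b ≡ true × pos a < p × p < pos b
    crossing = walk-crosses G pos p walk (subst (_< p) (sym (pos-vertexAt 0 0<n)) 0<p)
                                         (subst (p <_) (sym (pos-vertexAt (suc p) 1+p<n)) (n<1+n p))

∑-𝟙[0<<pred[n]]≡n∸2 : ∀ n → ∑[ p < n ] 𝟙[ 0 < toℕ p < pred n ] ≡ n ∸ 2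
∑-𝟙[0<<pred[n]]≡n∸2 zero    = refl
∑-𝟙[0<<pred[n]]≡n∸2 (suc n) = trans (∑-𝟙[<<] 0 n (suc n)) (cong (_∸ 1) (m≥n⇒m⊓n≡n (n≤1+n n)))

lemma3p1 : (n : ℕ) (G : Graph n) → TwoConnected G →
    (α : LinearArrangement n) → n ∸ 2 ≤ nc α G
lemma3p1 n G (mk2c _ _ 2conn) α = begin
  n ∸ 2                                ≡⟨ ∑-𝟙[0<<pred[n]]≡n∸2 n ⟨
  ∑[ p < n ] 𝟙[ 0 < toℕ p < pred n ]
    ≤⟨ ∑-mono-≤ {n} (λ p → 𝟙[<<]-≤ (interior-crossed G α 2conn {toℕ p})) ⟩
  ∑[ p < n ] crossings (toℕ p)         ≤⟨ ∑-crossings≤∑∑-stretch n ⟩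
  ∑[ u < n ] ∑[ v < n ] stretch u v    ≡⟨ nc≡∑∑-stretch G α ⟨
  nc α G                               ∎
  where
  open ≤-Reasoning
  open DoubleCounting (edge G α) (Arrangement.pos α)
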